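{- For every FDAG $D\neq D_0$, let $f(D)$ denote the unique FDAG from which $D$ is obtained by one application of the branching, elongation or widening rule. Then (i) $f(D)$ is a proper subgraph of $D$, obtained from $D$ by deleting either one vertex together with its outgoing arcs or a single arc; and (ii) for every FDAG $D\neq D_0$ there exists an integer $k\ge1$ with $f^k(D)=D_0$. Consequently, $f$ is a reduction rule and the three expansion rules define an enumeration tree rooted at $D_0$ whose nodes are exactly all FDAGs.
   Context: Trees are finite unordered rooted trees. In a directed multigraph, $\mathrm{child}(v)$ is the multiset of heads of arcs leaving $v$ (with multiplicity); $h(v)=0$ if $v$ has no children, else $1+\max_{u\in\mathrm{child}(v)}h(u)$. An irredundant forest is a finite set of trees none of which is isomorphic to a subtree (vertex plus all descendants) of another. The DAG reduction $\mathcal{R}(F)$ has one vertex per isomorphism class of subtrees occurring in $F$, with, from the class of $T[v]$ to a class $c'$, as many arcs as $v$ has children $u$ with $T[u]\in c'$. An FDAG is a directed acyclic multigraph of the form $\mathcal{R}(F)$, $F$ an irredundant forest; equivalently a finite connected directed acyclic multigraph whose distinct vertices have distinct multisets of children. $D_0$ is the FDAG with one vertex and no arcs. $<_{\mathrm{lex}}$ is the lexicographical order on words (a proper prefix is smaller; otherwise compare at the first differing letter); a word $a_0\cdots a_m$ is decreasing if $a_i\ge a_{i+1}$ for all $i$. $SC(w)$ removes the last letter of a nonempty word, $SC(\epsilon)=\epsilon$. For a bijection $\psi:V(D)\to\{0,\dots,\#D-1\}$, $\mathrm{child}_\psi(v)$ lists $\psi(w)$, $w\in\mathrm{child}(v)$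 with multiplicity, in non-increasing order. The canonical ordering of an FDAG is the unique such bijection with $\psi(u)>\psi(v)$ whenever there is an arc $u\to v$, $h(u)>h(v)\Rightarrow\psi(u)>\psi(v)$, and ($h(u)=h(v)$ and $\mathrm{child}_\psi(u)>_{\mathrm{lex}}\mathrm{child}_\psi(v))\Rightarrow\psi(u)>\psi(v)$; write $D=(v_0,\dots,v_n)$ with $\psi(v_i)=i$, $\mathcal{A}_==\{\psi(v):h(v)=h(v_n)\}$, $\mathcal{A}_<=\{\psi(v):h(v)<h(v_n)\}$. Expansion rules: (Branching) with $\mathrm{child}_\psi(v_n)=a_0\cdots a_m$, choose $a\in\mathcal{A}_<$ with $a\le a_m$ (any $a\in\mathcal{A}_<$ if the word is empty) and add one arc from $v_n$ to $\psi^{ -1}(a)$. (Elongation) add a new vertex $v_{n+1}$ with exactly one arc, to $\psi^{ -1}(a)$ for some $a\in\mathcal{A}_=$. (Widening) add a new vertex $v_{n+1}$ whose children word is a minimal word of $\mathcal{L}_<(\overline{w})$, where $\overline{w}=\mathrm{child}_\psi(v_n)$, $\mathcal{L}_<(\overline{w})$ is the set of decreasing words $w$ over $\mathcal{A}_<$ with $w>_{\mathrm{lex}}\overline{w}$, and $w$ is minimal if $w\in\mathcal{L}_<(\overline{w})$ but $SC(w)\notin\mathcal{L}_<(\overline{w})$. It is known (and may be used) that each FDAG $D\neq D_0$ has a unique such antecedent. A reduction rule on a poset $(\mathbb{S},\subseteq)$ with least element $\emptyset$ (here $D_0$) is a map $f:\mathbb{S}\setminus\{\emptyset\}\to\mathbb{S}$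 with $f(s)\subsetneq s$ and such that for every $s$ some iterate $f^k(s)$ equals $\emptyset$. -}

module Defs where

open import Data.Nat using (ℕ; zero; suc; _≤_; _<_; _⊔_; _≤ᵇ_)
open import Data.Bool using (if_then_else_)
open import Data.Fin using (Fin; zero; suc; toℕ; fromℕ; _≟_)
open import Data.Fin.Permutation using (Permutation′; _⟨$⟩ʳ_; _⟨$⟩ˡ_)
open import Data.List using (List; []; _∷_; map; foldr)
open import Data.List.Membership.Propositional using (_∈_)
open import Data.List.Relation.Binary.Permutation.Propositional using (_↭_)
open import Data.List.Relation.Unary.All using (All)
open import Data.List.Relation.Unary.Linked using (Linked)
open import Data.Product using (Σ; ∃; _×_; _,_)
open import Data.Sum using (_⊎_)
open import Data.Unit using (⊤)
open import Data.Empty using (⊥)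
open import Relation.Nullary using (¬_; yes; no)
open import Relation.Binary.PropositionalEquality using (_≡_; _≢_)
open import Function.Definitions using (Injective)

-- Finite directed multigraphs: vertices Fin size, child v = list of
-- heads of arcs leaving v (with multiplicity; order irrelevant, all
-- comparisons of children are up to permutation _↭_).

record Graph : Set where
  constructor mkG
  field
    size : ℕ
    ch   : Fin size → List (Fin size)
open Graph public

D₀ : Graph
D₀ = mkG 1 (λ _ → [])

data Path (G : Graph) : Fin (size G) → Fin (size G) → Set where
  arc  : ∀ {u v} → v ∈ ch G u → Path G u v
  _▸_  : ∀ {u v w} → v ∈ ch G u → Path G v w → Path G u w

data Conn (G : Graph) : Fin (size G) → Fin (size G) → Set where
  here : ∀ {u} → Conn G u u
  fwd  : ∀ {u v w} → v ∈ ch G u → Conn G v w → Conn G u w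
  bwd  : ∀ {u v w} → u ∈ ch G v → Conn G v w → Conn G u w

Acyclic : Graph → Set
Acyclic G = ∀ v → ¬ Path G v v

Connected : Graph → Set
Connected G = (1 ≤ size G) × (∀ u v → Conn G u v)

IsFDAG : Graph → Set
IsFDAG G = Acyclic G × Connected G
         × (∀ u v → ch G u ↭ ch G v → u ≡ v)

_≅_ : Graph → Graph → Set
A ≅ D = Σ (Fin (size A) → Fin (size D)) λ e →
          Injective _≡_ _≡_ e × (∀ v → ∃ λ i → e i ≡ v)
          × (∀ i → ch D (e i) ↭ map e (ch A i))

-- A is obtained from D by deleting one vertex x together with its
-- outgoing arcs (e embeds A into D, hitting every vertex but x; arcs
-- of D between the remaining vertices are exactly those of A).
DelVertex : Graph → Graph → Set
DelVertex A D = Σ (Fin (size A) → Fin (size D)) λ e → Σ (Fin (size D)) λ x →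
          Injective _≡_ _≡_ e × (∀ i → e i ≢ x) × (∀ v → v ≢ x → ∃ λ i → e i ≡ v)
          × (∀ i → ch D (e i) ↭ map e (ch A i))

DelArc : Graph → Graph → Set
DelArc A D = Σ (Fin (size A) → Fin (size D)) λ e →
          Injective _≡_ _≡_ e × (∀ v → ∃ λ i → e i ≡ v)
          × Σ (Fin (size A)) λ x → Σ (Fin (size A)) λ y →
              (ch D (e x) ↭ e y ∷ map e (ch A x))
            × (∀ i → i ≢ x → ch D (e i) ↭ map e (ch A i))

-- Height.  h(v) = 0 if no children, else 1 + max over children.
-- Computed with fuel = number of vertices, which is enough for
-- acyclic graphs (every path has < size arcs).

maxList : List ℕ → ℕ
maxList = foldr _⊔_ 0

hfuel : (G : Graph) → ℕ → Fin (size G) → ℕ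
hfuel G zero    v = 0
hfuel G (suc k) v with ch G v
... | []    = 0
... | c ∷ cs = suc (maxList (map (hfuel G k) (c ∷ cs)))

height : (G : Graph) → Fin (size G) → ℕ
height G = hfuel G (size G)

insertDesc : ℕ → List ℕ → List ℕ
insertDesc x []       = x ∷ []
insertDesc x (y ∷ ys) = if y ≤ᵇ x then x ∷ y ∷ ys else y ∷ insertDesc x ys

sortDesc : List ℕ → List ℕ
sortDesc = foldr insertDesc []

data _<lex_ : List ℕ → List ℕ → Set where
  halt : ∀ {y ys} → [] <lex (y ∷ ys)
  this : ∀ {x y xs ys} → x < y → (x ∷ xs) <lex (y ∷ ys)
  next : ∀ {x xs ys} → xs <lex ys → (x ∷ xs) <lex (x ∷ ys)

Decreasing : List ℕ → Set
Decreasing w = Linked (λ a b → b ≤ a) w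

-- SC : remove the last letter (SC ε = ε)
SC : {A : Set} → List A → List A
SC []           = []
SC (x ∷ [])     = []
SC (x ∷ y ∷ ys) = x ∷ SC (y ∷ ys)

lastOf : ℕ → List ℕ → ℕ
lastOf x []       = x
lastOf x (y ∷ ys) = lastOf y ys

childψ : (G : Graph) → Permutation′ (size G) → Fin (size G) → List ℕ
childψ G ψ v = sortDesc (map (λ w → toℕ (ψ ⟨$⟩ʳ w)) (ch G v))

IsCanonical : (G : Graph) → Permutation′ (size G) → Set
IsCanonical G ψ =
    (∀ u v → v ∈ ch G u → toℕ (ψ ⟨$⟩ʳ v) < toℕ (ψ ⟨$⟩ʳ u))
  × (∀ u v → height G v < height G u → toℕ (ψ ⟨$⟩ʳ v) < toℕ (ψ ⟨$⟩ʳ u))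
  × (∀ u v → height G u ≡ height G v → childψ G ψ v <lex childψ G ψ u
           → toℕ (ψ ⟨$⟩ʳ v) < toℕ (ψ ⟨$⟩ʳ u))

-- Expansion rules, applied to a graph with suc n vertices and a
-- canonical ordering ψ; vₙ = ψ⁻¹(n).  Letters a are labels ψ(v) ∈ Fin (suc n).

module Rules (n : ℕ) (c : Fin (suc n) → List (Fin (suc n)))
             (ψ : Permutation′ (suc n)) where

  G : Graph
  G = mkG (suc n) c

  vtop : Fin (suc n)
  vtop = ψ ⟨$⟩ˡ fromℕ n

  In𝒜< : Fin (suc n) → Set
  In𝒜< a = height G (ψ ⟨$⟩ˡ a) < height G vtop

  In𝒜= : Fin (suc n) → Set
  In𝒜= a = height G (ψ ⟨$⟩ˡ a) ≡ height G vtop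

  w̄ : List ℕ
  w̄ = childψ G ψ vtop

  BranchOK : Fin (suc n) → List ℕ → Set
  BranchOK a []       = ⊤
  BranchOK a (x ∷ xs) = toℕ a ≤ lastOf x xs

  branchG : Fin (suc n) → Graph
  branchG a = mkG (suc n) λ v → if isTop v then (ψ ⟨$⟩ˡ a) ∷ c v else c v
    where
      isTop : Fin (suc n) → Data.Bool.Bool
      isTop v with v ≟ vtop
      ... | yes _ = Data.Bool.true
      ... | no _  = Data.Bool.false

  addVertex : List (Fin (suc n)) → Graph
  addVertex w = mkG (suc (suc n)) ch′
    where
      ch′ : Fin (suc (suc n)) → List (Fin (suc (suc n)))
      ch′ zero    = map (λ a → suc (ψ ⟨$⟩ˡ a)) w
      ch′ (suc v) = map suc (c v)

  In𝓛< : List (Fin (suc n)) → Set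
  In𝓛< w = Decreasing (map toℕ w) × All In𝒜< w × (w̄ <lex map toℕ w)

  Minimal : List (Fin (suc n)) → Set
  Minimal w = In𝓛< w × ¬ In𝓛< (SC w)

  Step : Graph → Set
  Step D =
      (Σ (Fin (suc n)) λ a → In𝒜< a × BranchOK a w̄ × (D ≅ branchG a))
    ⊎ (Σ (Fin (suc n)) λ a → In𝒜= a × (D ≅ addVertex (a ∷ [])))
    ⊎ (Σ (List (Fin (suc n))) λ w → Minimal w × (D ≅ addVertex w))

Expands : Graph → Graph → Set
Expands (mkG zero c)    D = ⊥
Expands (mkG (suc n) c) D =
  Σ (Permutation′ (suc n)) λ ψ → IsCanonical (mkG (suc n) c) ψ × Rules.Step n c ψ D

iter : (Graph → Graph) → ℕ → Graph → Graph
iter f zero    D = D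
iter f (suc k) D = iter f k (f D)

-- Each expansion rule adds either one arc (branching) or one new vertex together with its
-- outgoing arcs (elongation, widening), so the antecedent f(D) is D with an arc or a vertex
-- deleted.  Hence f strictly decreases the number of vertices plus arcs; as f applies to
-- every FDAG other than D₀, iterating it must reach D₀.

module Submission where

open import Defs
open import Data.Nat using (ℕ; _≤_)
open import Data.Product using (Σ; _×_)
open import Data.Sum using (_⊎_)
open import Relation.Nullary using (¬_)

open import Data.Nat using (zero; suc; _<_; z≤n; s≤s)
open import Data.Nat.Properties using (≤-reflexive; ≤-trans; n≤1+n; m≤n+m; +-mono-≤; +-mono-<-≤; +-mono-≤-<; +-0-commutativeMonoid; module ≤-Reasoning)
import Data.Nat.Properties as ℕ
open import Data.Nat.Induction using (<-wellFounded)
open import Data.Fin using (Fin; zero; suc; _≟_)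
open import Data.Fin.Properties using (suc-injective)
open import Data.Fin.Permutation using (Permutation; Permutation′; permutation; _⟨$⟩ˡ_; ↔⇒≡)
import Data.Vec.Functional as Vector
open import Data.List using (List; []; _∷_; map; length)
open import Data.List.Properties using (map-∘; map-cong; map-id; length-map)
open import Data.List.Relation.Binary.Permutation.Propositional using (_↭_; ↭-refl; ↭-trans; ↭-reflexive; prep; module PermutationReasoning)
open import Data.List.Relation.Binary.Permutation.Propositional.Properties using (↭-length; map⁺)
open import Data.List.Relation.Unary.Any using (here)
open import Data.List.Membership.Propositional using (_∈_)
open import Data.Product using (_,_; proj₁; proj₂; ∃)
open import Data.Sum using (inj₁; inj₂)
open import Data.Empty using (⊥-elim)
open import Function using (_∘_; id)
open import Function.Definitions using (Injective)
open import Induction.WellFounded using (Acc; acc)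
open import Relation.Nullary using (Dec; yes; no)
open import Relation.Binary.PropositionalEquality using (_≡_; _≢_; refl; sym; trans; cong; subst)
open import Algebra.Properties.CommutativeMonoid.Sum +-0-commutativeMonoid using (sum; sum-permute; sum-cong-≗)

Surjective : ∀ {m n} → (Fin m → Fin n) → Set
Surjective e = ∀ v → ∃ λ i → e i ≡ v

bijective⇒permutation : ∀ {m n} (e : Fin m → Fin n) → Injective _≡_ _≡_ e → Surjective e
                      → Permutation m n
bijective⇒permutation e e-inj e-surj =
  permutation e (proj₁ ∘ e-surj) (proj₂ ∘ e-surj) (λ i → e-inj (proj₂ (e-surj (e i))))

sum-reindex : ∀ {m n} (e : Fin m → Fin n) → Injective _≡_ _≡_ e → Surjective e
            → (g : Fin n → ℕ) → sum g ≡ sum (g ∘ e)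
sum-reindex e e-inj e-surj g = sum-permute g (bijective⇒permutation e e-inj e-surj)

sum-mono-≤ : ∀ {n} (f g : Fin n → ℕ) → (∀ i → f i ≤ g i) → sum f ≤ sum g
sum-mono-≤ {zero}  f g f≤g = z≤n
sum-mono-≤ {suc n} f g f≤g = +-mono-≤ (f≤g zero) (sum-mono-≤ (f ∘ suc) (g ∘ suc) (f≤g ∘ suc))

sum-mono-< : ∀ {n} (f g : Fin n → ℕ) → (∀ i → f i ≤ g i) → ∀ j → f j < g j → sum f < sum g
sum-mono-< {suc n} f g f≤g zero    fj<gj = +-mono-<-≤ fj<gj (sum-mono-≤ (f ∘ suc) (g ∘ suc) (f≤g ∘ suc))
sum-mono-< {suc n} f g f≤g (suc j) fj<gj = +-mono-≤-< (f≤g zero) (sum-mono-< (f ∘ suc) (g ∘ suc) (f≤g ∘ suc) j fj<gj)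

map-↭-∘ : ∀ {A B C : Set} (g : B → C) {f : A → B} {ys : List B} {xs : List A}
        → ys ↭ map f xs → map g ys ↭ map (g ∘ f) xs
map-↭-∘ g {xs = xs} p = ↭-trans (map⁺ g p) (↭-reflexive (sym (map-∘ xs)))

↭-length-map : ∀ {A B : Set} {f : A → B} {ys : List B} {xs : List A}
             → ys ↭ map f xs → length ys ≡ length xs
↭-length-map {f = f} {xs = xs} p = trans (↭-length p) (length-map f xs)

≅-sym : ∀ {A B} → A ≅ B → B ≅ A
≅-sym {A} {B} (e , e-inj , e-surj , e-ch) = e⁻¹ , e⁻¹-inj , (λ i → e i , e⁻¹∘e i) , e⁻¹-ch
  where
    e⁻¹ : Fin (size B) → Fin (size A)
    e⁻¹ = proj₁ ∘ e-surj

    e∘e⁻¹ : ∀ v → e (e⁻¹ v) ≡ v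
    e∘e⁻¹ = proj₂ ∘ e-surj

    e⁻¹∘e : ∀ i → e⁻¹ (e i) ≡ i
    e⁻¹∘e i = e-inj (e∘e⁻¹ (e i))

    e⁻¹-inj : Injective _≡_ _≡_ e⁻¹
    e⁻¹-inj {u} {v} p = trans (sym (e∘e⁻¹ u)) (trans (cong e p) (e∘e⁻¹ v))

    e⁻¹-ch : ∀ v → ch A (e⁻¹ v) ↭ map e⁻¹ (ch B v)
    e⁻¹-ch v = begin
      ch A (e⁻¹ v)                      ≡⟨ sym (map-id _) ⟩
      map id (ch A (e⁻¹ v))             ≡⟨ sym (map-cong e⁻¹∘e _) ⟩
      map (e⁻¹ ∘ e) (ch A (e⁻¹ v))      ↭⟨ map-↭-∘ e⁻¹ (subst (λ u → ch B u ↭ map e (ch A (e⁻¹ v))) (e∘e⁻¹ v) (e-ch (e⁻¹ v))) ⟨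
      map e⁻¹ (ch B v)                  ∎
      where open PermutationReasoning

DelArc-respʳ-≅ : ∀ {A B D} → DelArc A B → B ≅ D → DelArc A D
DelArc-respʳ-≅ (e , e-inj , e-surj , x , y , at-x , off-x) (g , g-inj , g-surj , g-ch) =
  g ∘ e , e-inj ∘ g-inj , surj , x , y , ↭-trans (g-ch (e x)) (map-↭-∘ g at-x) ,
  λ i i≢x → ↭-trans (g-ch (e i)) (map-↭-∘ g (off-x i i≢x))
  where
    surj : Surjective (g ∘ e)
    surj v with g-surj v
    ... | j , refl with e-surj j
    ... | i , refl = i , refl

DelVertex-respʳ-≅ : ∀ {A B D} → DelVertex A B → B ≅ D → DelVertex A D
DelVertex-respʳ-≅ (e , x , e-inj , e≢x , e-surj , e-ch) (g , g-inj , g-surj , g-ch) =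
  g ∘ e , g x , e-inj ∘ g-inj , (λ i → e≢x i ∘ g-inj) , surj ,
  λ i → ↭-trans (g-ch (e i)) (map-↭-∘ g (e-ch i))
  where
    surj : ∀ v → v ≢ g x → ∃ λ i → g (e i) ≡ v
    surj v v≢gx with g-surj v
    ... | j , refl with e-surj j (v≢gx ∘ cong g)
    ... | i , refl = i , refl

module _ (n : ℕ) (c : Fin (suc n) → List (Fin (suc n))) (ψ : Permutation′ (suc n)) where
  open Rules n c ψ

  branchG-DelArc : ∀ a → DelArc G (branchG a)
  branchG-DelArc a = id , id , (λ v → v , refl) , vtop , ψ ⟨$⟩ˡ a , at-top , off-top
    where
      at-top : ch (branchG a) vtop ↭ (ψ ⟨$⟩ˡ a) ∷ map id (c vtop)
      at-top with vtop ≟ vtop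
      ... | yes _ = prep _ (↭-reflexive (sym (map-id _)))
      ... | no vtop≢vtop = ⊥-elim (vtop≢vtop refl)
      off-top : ∀ v → v ≢ vtop → ch (branchG a) v ↭ map id (c v)
      off-top v v≢vtop with v ≟ vtop
      ... | yes v≡vtop = ⊥-elim (v≢vtop v≡vtop)
      ... | no _ = ↭-reflexive (sym (map-id _))

  addVertex-DelVertex : ∀ w → DelVertex G (addVertex w)
  addVertex-DelVertex w = suc , zero , suc-injective , (λ i ()) , surj , λ i → ↭-refl
    where
      surj : ∀ v → v ≢ zero → ∃ λ i → suc i ≡ v
      surj zero    v≢0 = ⊥-elim (v≢0 refl)
      surj (suc i) _   = i , refl

  ≅branchG⇒DelArc : ∀ {a D} → D ≅ branchG a → DelArc G D
  ≅branchG⇒DelArc {a} {D} D≅B = DelArc-respʳ-≅ {G} {branchG a} {D} (branchG-DelArc a) (≅-sym {D} D≅B)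

  ≅addVertex⇒DelVertex : ∀ {w D} → D ≅ addVertex w → DelVertex G D
  ≅addVertex⇒DelVertex {w} {D} D≅B =
    DelVertex-respʳ-≅ {G} {addVertex w} {D} (addVertex-DelVertex w) (≅-sym {D} D≅B)

Expands⇒deletion : ∀ {A D} → Expands A D → DelVertex A D ⊎ DelArc A D
Expands⇒deletion {mkG (suc n) c} (ψ , _ , inj₁ (_ , _ , _ , D≅B))      = inj₂ (≅branchG⇒DelArc n c ψ D≅B)
Expands⇒deletion {mkG (suc n) c} (ψ , _ , inj₂ (inj₁ (_ , _ , D≅B))) = inj₁ (≅addVertex⇒DelVertex n c ψ D≅B)
Expands⇒deletion {mkG (suc n) c} (ψ , _ , inj₂ (inj₂ (_ , _ , D≅B))) = inj₁ (≅addVertex⇒DelVertex n c ψ D≅B)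

vertices+arcs : Graph → ℕ
vertices+arcs G = sum (λ v → suc (length (ch G v)))

DelArc⇒vertices+arcs< : ∀ {A D} → DelArc A D → vertices+arcs A < vertices+arcs D
DelArc⇒vertices+arcs< {A} {D} (e , e-inj , e-surj , x , _ , at-x , off-x) = begin-strict
  vertices+arcs A    <⟨ sum-mono-< _ (degD ∘ e) grows x (≤-reflexive (sym degD-at-x)) ⟩
  sum (degD ∘ e)     ≡⟨ sum-reindex e e-inj e-surj degD ⟨
  vertices+arcs D    ∎
  where
    open ≤-Reasoning

    degD : Fin (size D) → ℕ
    degD v = suc (length (ch D v))

    degD-at-x : degD (e x) ≡ suc (suc (length (ch A x)))
    degD-at-x = cong suc (↭-length-map at-x)

    grows : ∀ i → suc (length (ch A i)) ≤ degD (e i)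
    grows i with i ≟ x
    ... | yes refl = ≤-trans (n≤1+n _) (≤-reflexive (sym degD-at-x))
    ... | no i≢x   = ≤-reflexive (cong suc (sym (↭-length-map (off-x i i≢x))))

DelVertex⇒vertices+arcs< : ∀ {A D} → DelVertex A D → vertices+arcs A < vertices+arcs D
DelVertex⇒vertices+arcs< {A} {D} (e , x , e-inj , e≢x , e-surj , e-ch) = begin-strict
  vertices+arcs A    ≡⟨ sum-cong-≗ deg ⟩
  sum (degD ∘ e)     <⟨ s≤s (m≤n+m _ _) ⟩
  sum (degD ∘ e⁺)    ≡⟨ sum-reindex e⁺ e⁺-inj e⁺-surj degD ⟨
  vertices+arcs D    ∎
  where
    open ≤-Reasoning

    degD : Fin (size D) → ℕ
    degD v = suc (length (ch D v))

    deg : ∀ i → suc (length (ch A i)) ≡ degD (e i)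
    deg i = cong suc (sym (↭-length-map (e-ch i)))

    e⁺ : Fin (suc (size A)) → Fin (size D)
    e⁺ = x Vector.∷ e

    e⁺-inj : Injective _≡_ _≡_ e⁺
    e⁺-inj {zero}  {zero}  _     = refl
    e⁺-inj {zero}  {suc j} x≡ej  = ⊥-elim (e≢x j (sym x≡ej))
    e⁺-inj {suc i} {zero}  ei≡x  = ⊥-elim (e≢x i ei≡x)
    e⁺-inj {suc i} {suc j} ei≡ej = cong suc (e-inj ei≡ej)

    e⁺-surj : Surjective e⁺
    e⁺-surj v with v ≟ x
    ... | yes refl = zero , refl
    ... | no v≢x with e-surj v v≢x
    ...   | i , ei≡v = suc i , ei≡v

deletion⇒vertices+arcs< : ∀ {A D} → DelVertex A D ⊎ DelArc A D → vertices+arcs A < vertices+arcs D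
deletion⇒vertices+arcs< {A} {D} (inj₁ del) = DelVertex⇒vertices+arcs< {A} {D} del
deletion⇒vertices+arcs< {A} {D} (inj₂ del) = DelArc⇒vertices+arcs< {A} {D} del

≅D₀⇒size≡1 : ∀ {D} → D ≅ D₀ → size D ≡ 1
≅D₀⇒size≡1 (e , e-inj , e-surj , _) = ↔⇒≡ (bijective⇒permutation e e-inj e-surj)

size≡1⇒≅D₀ : ∀ {D} → Acyclic D → size D ≡ 1 → D ≅ D₀
size≡1⇒≅D₀ {mkG .1 c} acyclic refl = (λ _ → zero) , const-inj , (λ { zero → zero , refl }) , leaf
  where
    const-inj : Injective _≡_ _≡_ (λ (_ : Fin 1) → Fin.zero {0})
    const-inj {zero} {zero} _ = refl

    leaf : ∀ i → [] ↭ map (λ _ → zero) (c i)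
    leaf zero with c zero in eq
    ... | []    = ↭-refl
    ... | zero ∷ _ = ⊥-elim (acyclic zero (arc (subst (zero ∈_) (sym eq) (here refl))))

≅D₀? : ∀ D → Acyclic D → Dec (D ≅ D₀)
≅D₀? D acyclic with size D ℕ.≟ 1
... | yes size≡1 = yes (size≡1⇒≅D₀ acyclic size≡1)
... | no size≢1  = no (size≢1 ∘ ≅D₀⇒size≡1)

module _ (f : Graph → Graph)
         (f-expands : ∀ D → IsFDAG D → ¬ (D ≅ D₀) → IsFDAG (f D) × Expands (f D) D) where

  iter-reaches-D₀ : ∀ D → IsFDAG D → Acc _<_ (vertices+arcs D) → ∃ λ k → iter f k D ≅ D₀
  iter-reaches-D₀ D fdag (acc rec) with ≅D₀? D (proj₁ fdag)
  ... | yes D≅D₀ = 0 , D≅D₀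
  ... | no D≇D₀ with f-expands D fdag D≇D₀
  ...   | fD-fdag , expands
    with iter-reaches-D₀ (f D) fD-fdag (rec (deletion⇒vertices+arcs< {f D} {D} (Expands⇒deletion {f D} {D} expands)))
  ...     | k , reached = suc k , reached

theorem2p12 : (f : Graph → Graph)
    → (∀ D → IsFDAG D → ¬ (D ≅ D₀) → IsFDAG (f D) × Expands (f D) D)
    → ∀ D → IsFDAG D → ¬ (D ≅ D₀)
    → (DelVertex (f D) D ⊎ DelArc (f D) D)
    × Σ ℕ (λ k → (1 ≤ k) × (iter f k D ≅ D₀))
theorem2p12 f f-expands D fdag D≇D₀ with f-expands D fdag D≇D₀
... | fD-fdag , expands with iter-reaches-D₀ f f-expands (f D) fD-fdag (<-wellFounded _)
... | k , reached = Expands⇒deletion expands , suc k , s≤s z≤n , reached
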